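{- $|V(\mathcal{I}')|=nd(d-1)^{l r_G-1}/2$ and $\Delta(\mathcal{I}')\le(l+1)^2d(d-1)^{l r_G-1}$, where $V(\mathcal{I}')$ and $\Delta(\mathcal{I}')$ are the vertex set and maximum degree of $\mathcal{I}'(G,l)$.
   Context: $G$ is a $d$-regular graph on $n$ vertices with $d\in[3,\mathcal{O}(\log n)]$ and girth at least $10l(\log\log n)^2$, $l$ an integer with $l=\omega(1)$, $l=o(\log_d n)$, and $r_G=\lceil 2\log_{d-1}\log n\rceil$. An $(l r_G)$-walk is a path $(u_0,u_1,\dots,u_{l r_G})$ of length $l r_G$ in $G$ (the vertices visited by a non-backtracking walk of that length); its set of potential choices is $\{u_{j r_G}:0\le j\le l\}$. The interference graph $\mathcal{I}'(G,l)$ has as vertices the sets of potential choices of the $(l r_G)$-walks of $G$, two vertices adjacent iff the sets intersect. -}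

module Defs where

open import Data.Nat using (ℕ; zero; suc; _+_; _*_; _∸_; _^_; _≤_; _<_; s≤s)
open import Data.Nat.Properties using (*-monoˡ-≤)
open import Data.Bool using (Bool; true; false; if_then_else_)
open import Data.Fin using (Fin; zero; suc; toℕ; fromℕ; fromℕ<; inject₁; _≟_)
open import Data.Fin.Properties using (toℕ≤pred[n])
open import Data.Fin.Subset using (Subset; _∩_; Nonempty) renaming (_∈_ to _∈ₛ_)
open import Data.List using (List; allFin; map; length)
open import Data.Nat.ListAction using (sum)
open import Data.Bool.ListAction using (any)
open import Data.List.Membership.Propositional using (_∈_)
open import Data.List.Relation.Unary.All using (All)
open import Data.List.Relation.Unary.Unique.Propositional using (Unique)
open import Data.Vec using (tabulate)
open import Data.Product using (Σ; ∃; _×_; _,_; proj₁)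
open import Function.Definitions using (Injective)
open import Relation.Binary.PropositionalEquality using (_≡_; _≢_)
open import Relation.Nullary.Decidable using (⌊_⌋)

record Graph (n : ℕ) : Set where
  field
    adj    : Fin n → Fin n → Bool
    sym    : ∀ u v → adj u v ≡ adj v u
    irrefl : ∀ u → adj u u ≡ false
open Graph public

degree : ∀ {n} → Graph n → Fin n → ℕ
degree {n} G u = sum (map (λ v → if adj G u v then 1 else 0) (allFin n))

Regular : ∀ {n} → Graph n → ℕ → Set
Regular {n} G d = ∀ (u : Fin n) → degree G u ≡ d

record GPath {n : ℕ} (G : Graph n) (L : ℕ) : Set where
  field
    vtx      : Fin (suc L) → Fin n
    adjacent : ∀ (i : Fin L) → adj G (vtx (inject₁ i)) (vtx (suc i)) ≡ true
    distinct : Injective _≡_ _≡_ vtx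
open GPath public

-- A cycle of length m+1 (m ≥ 2): a path u_0,...,u_m with u_m adjacent to u_0.
IsCycle : ∀ {n} {G : Graph n} {m : ℕ} → GPath G m → Set
IsCycle {G = G} {m = m} p = 2 ≤ m × adj G (vtx p (fromℕ m)) (vtx p zero) ≡ true

GirthAtLeast : ∀ {n} → Graph n → ℕ → Set
GirthAtLeast G g = ∀ (m : ℕ) (p : GPath G m) → IsCycle p → g ≤ suc m

stepIndex : (l r : ℕ) → Fin (suc l) → Fin (suc (l * r))
stepIndex l r j = fromℕ< (s≤s (*-monoˡ-≤ r (toℕ≤pred[n] j)))

potentialChoices : ∀ {n} {G : Graph n} (l r : ℕ) → GPath G (l * r) → Subset n
potentialChoices {n} l r p =
  tabulate (λ v → any (λ j → ⌊ vtx p (stepIndex l r j) ≟ v ⌋) (allFin (suc l)))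

IsVertex : ∀ {n} → Graph n → (l r : ℕ) → Subset n → Set
IsVertex G l r S = ∃ λ (p : GPath G (l * r)) → potentialChoices l r p ≡ S

IAdj : ∀ {n} → Graph n → (l r : ℕ) → Subset n → Subset n → Set
IAdj G l r S T = IsVertex G l r T × T ≢ S × Nonempty (S ∩ T)

VertexCount : ∀ {n} → Graph n → (l r : ℕ) → ℕ → Set
VertexCount G l r N =
  Σ (List (Subset _)) λ xs → Unique xs × length xs ≡ N ×
    (∀ S → (S ∈ xs → IsVertex G l r S) × (IsVertex G l r S → S ∈ xs))

MaxDegreeAtMost : ∀ {n} → Graph n → (l r : ℕ) → ℕ → Set
MaxDegreeAtMost G l r B =
  ∀ S → IsVertex G l r S →
    ∀ (ys : List (Subset _)) → Unique ys → All (IAdj G l r S) ys → length ys ≤ B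

module Submission where

-- Let L = l r. Girth > 2L makes non-backtracking walks of length at most 2L into paths, and makes two
-- paths with common ends and total length below the girth coincide: otherwise going out along one and
-- back along the other is a closed non-backtracking walk. A d-regular graph has n d (d − 1)^(L − 1)
-- non-backtracking walks of length L. If paths x and y of length L have the same potential choices,
-- the ends of y are choices of x, and the segment of x between them is a path with the ends of y, so
-- it is y; as it has length L it is all of x, read forwards or backwards. Hence every vertex of I' comes
-- from exactly two walks. A neighbour of the choice set of x contains some x_{jr} at a position i r of
-- its walk, and for each of the (l + 1)² pairs (j, i) there are d (d − 1)^(L − 1) such walks.

open import Defs hiding (sym)
open import Data.Bool using (Bool; true; false; if_then_else_)
open import Data.Bool.ListAction using (any; or)
open import Data.Bool.Properties using (T-≡)
open import Data.Empty using (⊥-elim)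
open import Data.Fin as Fin using (Fin; toℕ; fromℕ; fromℕ<; opposite; _≟_)
open import Data.Fin.Properties
  using (toℕ-injective; toℕ-inject₁; toℕ-fromℕ; toℕ-fromℕ<; toℕ<n; toℕ≤pred[n]; opposite-prop)
open import Data.Fin.Subset using (Subset; _⊆_) renaming (_∈_ to _∈ₛ_)
open import Data.Fin.Subset.Properties using (⊆-antisym; x∈p∩q⁻)
open import Data.List using (List; []; _∷_; _++_; length; map; filter; concatMap; allFin)
open import Data.List.Properties
  using (length-++; length-++-sucʳ; length-map; length-tabulate; ++-identityʳ; map-cong;
         filter-accept; filter-reject; filter-all)
open import Data.List.Membership.Propositional using (_∈_; find; lose)
open import Data.List.Membership.Propositional.Properties
  using (∈-∃++; ∈-++⁺ˡ; ∈-++⁺ʳ; ∈-++⁻; ∈-map⁺; ∈-map⁻; ∈-filter⁺; ∈-filter⁻; ∈-concatMap⁺; ∈-concatMap⁻;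
         ∈-allFin)
open import Data.List.NonEmpty as List⁺ using (List⁺; _∷_; _∷⁺_; [_])
open import Data.List.Relation.Binary.Disjoint.Propositional using (Disjoint)
open import Data.List.Relation.Unary.All as All using ([])
open import Data.List.Relation.Unary.All.Properties using () renaming (map⁺ to All-map⁺)
open import Data.List.Relation.Unary.AllPairs using ([]; _∷_)
open import Data.List.Relation.Unary.Any using (here; there)
open import Data.List.Relation.Unary.Any.Properties using (any⁺; any⁻)
open import Data.List.Relation.Unary.Unique.Propositional using (Unique)
open import Data.List.Relation.Unary.Unique.Propositional.Properties using (++⁺; filter⁺; allFin⁺)
open import Data.Nat using (ℕ; zero; suc; _+_; _*_; _∸_; _^_; _≤_; _<_; _/_; z≤n; s≤s; z<s; _≤?_; _<?_)
open import Data.Nat.DivMod using (m*n/n≡m)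
open import Data.Nat.ListAction using (sum)
open import Data.Nat.Properties hiding (_≟_)
open import Data.Nat.Tactic.RingSolver using (solve-∀)
open import Data.Product using (∃; _×_; _,_; proj₁; proj₂)
open import Data.Sum using (_⊎_; inj₁; inj₂)
open import Data.Vec using (tabulate)
open import Data.Vec.Properties using (tabulate-cong; lookup∘tabulate; []=⇒lookup; lookup⇒[]=)
open import Function using (_∘_)
open import Function.Bundles using (Equivalence)
open import Relation.Binary.Definitions using (DecidableEquality)
open import Relation.Binary.PropositionalEquality hiding ([_])
open import Relation.Nullary using (¬_; yes; no; ¬?; contradiction)
open import Relation.Nullary.Decidable using (T?; ⌊_⌋; toWitness; fromWitness)
open import Relation.Unary using (Pred; Decidable)
open import Relation.Unary.Properties using (∁?)

module _ {A B : Set} where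

  length-concatMap : (f : A → List B) {c : ℕ} (xs : List A) →
                     (∀ {x} → x ∈ xs → length (f x) ≡ c) →
                     length (concatMap f xs) ≡ length xs * c
  length-concatMap f []       _  = refl
  length-concatMap f (x ∷ xs) fx =
    trans (length-++ (f x)) (cong₂ _+_ (fx (here refl)) (length-concatMap f xs (fx ∘ there)))

  concatMap⁺ : (f : A → List B) {xs : List A} → (∀ x → Unique (f x)) →
               (∀ {x x′ y} → y ∈ f x → y ∈ f x′ → x ≡ x′) →
               Unique xs → Unique (concatMap f xs)
  concatMap⁺ f uf sep []                          = []
  concatMap⁺ f {x ∷ xs} uf sep (x∉xs ∷ unique-xs) =
    ++⁺ (uf x) (concatMap⁺ f uf sep unique-xs) disjoint
    where
    disjoint : Disjoint (f x) (concatMap f xs)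
    disjoint (y∈fx , y∈rest) with find (∈-concatMap⁻ f {xs = xs} y∈rest)
    ... | x′ , x′∈xs , y∈fx′ = All.lookup x∉xs x′∈xs (sep y∈fx y∈fx′)

  map⁺ : (f : A → B) {xs : List A} → (∀ {x y} → x ∈ xs → y ∈ xs → f x ≡ f y → x ≡ y) →
         Unique xs → Unique (map f xs)
  map⁺ f inj []             = []
  map⁺ f inj (x∉xs ∷ uxs) =
    All-map⁺ (All.tabulate λ y∈xs fx≡fy → All.lookup x∉xs y∈xs (inj (here refl) (there y∈xs) fx≡fy))
    ∷ map⁺ f (λ p q → inj (there p) (there q)) uxs

module _ {A : Set} where

  unique⊆⇒length≤ : {xs ys : List A} → Unique xs → (∀ {x} → x ∈ xs → x ∈ ys) →
                    length xs ≤ length ys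
  unique⊆⇒length≤ []             _   = z≤n
  unique⊆⇒length≤ {x ∷ xs} (x∉xs ∷ uxs) xs⊆ys with ∈-∃++ (xs⊆ys (here refl))
  ... | us , vs , refl = begin
    suc (length xs)            ≤⟨ s≤s (unique⊆⇒length≤ uxs xs⊆us++vs) ⟩
    suc (length (us ++ vs))    ≡⟨ length-++-sucʳ us x vs ⟨
    length (us ++ x ∷ vs)      ∎
    where
    open ≤-Reasoning
    xs⊆us++vs : ∀ {y} → y ∈ xs → y ∈ us ++ vs
    xs⊆us++vs {y} y∈xs with ∈-++⁻ us (xs⊆ys (there y∈xs))
    ... | inj₁ y∈us         = ∈-++⁺ˡ y∈us
    ... | inj₂ (here refl)  = ⊥-elim (All.lookup x∉xs y∈xs refl)
    ... | inj₂ (there y∈vs) = ∈-++⁺ʳ us y∈vs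

  length-filter-T : (p : A → Bool) (xs : List A) →
                    length (filter (T? ∘ p) xs) ≡ sum (map (λ x → if p x then 1 else 0) xs)
  length-filter-T p []       = refl
  length-filter-T p (x ∷ xs) with p x
  ... | true  = cong suc (length-filter-T p xs)
  ... | false = length-filter-T p xs

module _ {A : Set} (_≟_ : DecidableEquality A) where

  length-filter-≢ : ∀ {y xs} → Unique xs → y ∈ xs →
                    suc (length (filter (λ x → ¬? (x ≟ y)) xs)) ≡ length xs
  length-filter-≢ {y} {x ∷ xs} (x∉xs ∷ _) (here refl) =
    cong (λ zs → suc (length zs))
      (trans (filter-reject (λ z → ¬? (z ≟ y)) {xs = xs} (λ ¬x≡x → ¬x≡x refl))
             (filter-all (λ z → ¬? (z ≟ y)) (All.map (λ x≢z z≡x → x≢z (sym z≡x)) x∉xs)))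
  length-filter-≢ {y} {x ∷ xs} (x∉xs ∷ uxs) (there y∈xs) =
    trans (cong (λ zs → suc (length zs)) (filter-accept (λ z → ¬? (z ≟ y)) (All.lookup x∉xs y∈xs)))
          (cong suc (length-filter-≢ uxs y∈xs))

module _ {A : Set} {p} {P : Pred A p} (P? : Decidable P) where

  length-filter+∁ : ∀ xs → length (filter P? xs) + length (filter (∁? P?) xs) ≡ length xs
  length-filter+∁ []       = refl
  length-filter+∁ (x ∷ xs) with P? x
  ... | yes _ = cong suc (length-filter+∁ xs)
  ... | no  _ = trans (+-suc _ _) (cong suc (length-filter+∁ xs))

  length-filter-involution : (f : A → A) {xs : List A} → Unique xs →
    (∀ {x} → x ∈ xs → f x ∈ xs) → (∀ {x} → x ∈ xs → f (f x) ≡ x) →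
    (∀ {x} → x ∈ xs → P x → ¬ P (f x)) → (∀ {x} → x ∈ xs → ¬ P x → P (f x)) →
    length xs ≡ length (filter P? xs) * 2
  length-filter-involution f {xs} uxs f∈ ff P⇒¬Pf ¬P⇒Pf = begin
    length xs                                                ≡⟨ length-filter+∁ xs ⟨
    length (filter P? xs) + length (filter (∁? P?) xs)       ≡⟨ cong (length (filter P? xs) +_) |∁P|≡|P| ⟩
    length (filter P? xs) + length (filter P? xs)            ≡⟨ cong (length (filter P? xs) +_) (+-identityʳ _) ⟨
    2 * length (filter P? xs)                                ≡⟨ *-comm 2 (length (filter P? xs)) ⟩
    length (filter P? xs) * 2                                ∎
    where
    open ≡-Reasoning
    f-injective : ∀ {x y} → x ∈ xs → y ∈ xs → f x ≡ f y → x ≡ y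
    f-injective {x} {y} x∈ y∈ fx≡fy = trans (sym (ff x∈)) (trans (cong f fx≡fy) (ff y∈))
    transfer : ∀ {q r} {Q : Pred A q} {R : Pred A r} (Q? : Decidable Q) (R? : Decidable R) →
               (∀ {x} → x ∈ xs → Q x → R (f x)) →
               length (filter Q? xs) ≤ length (filter R? xs)
    transfer Q? R? Q⇒Rf = subst (_≤ length (filter R? xs)) (length-map f (filter Q? xs))
      (unique⊆⇒length≤ (map⁺ f (λ p q → f-injective (proj₁ (∈-filter⁻ Q? p)) (proj₁ (∈-filter⁻ Q? q)))
                                 (filter⁺ Q? uxs))
                       image⊆)
      where
      image⊆ : ∀ {y} → y ∈ map f (filter Q? xs) → y ∈ filter R? xs
      image⊆ y∈ with ∈-map⁻ f y∈
      ... | x , x∈ , refl with ∈-filter⁻ Q? x∈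
      ... | x∈xs , Qx = ∈-filter⁺ R? (f∈ x∈xs) (Q⇒Rf x∈xs Qx)
    |∁P|≡|P| : length (filter (∁? P?) xs) ≡ length (filter P? xs)
    |∁P|≡|P| = ≤-antisym (transfer (∁? P?) P? ¬P⇒Pf) (transfer P? (∁? P?) P⇒¬Pf)

module _ {A : Set} where

  InjectiveUpTo : ℕ → (ℕ → A) → Set
  InjectiveUpTo k f = ∀ {i j} → i ≤ k → j ≤ k → f i ≡ f j → i ≡ j

  reversed : ℕ → (ℕ → A) → ℕ → A
  reversed k f t = f (k ∸ t)

  join : ℕ → (ℕ → A) → (ℕ → A) → ℕ → A
  join m f h t with t ≤? m
  ... | yes _ = f t
  ... | no  _ = h (t ∸ m)

  join-≤ : ∀ {m f h t} → t ≤ m → join m f h t ≡ f t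
  join-≤ {m} {t = t} t≤m with t ≤? m
  ... | yes _   = refl
  ... | no  t≰m = contradiction t≤m t≰m

  join-+ : ∀ {m f h} t → f m ≡ h 0 → join m f h (t + m) ≡ h t
  join-+ {m} zero fm≡h0 with m ≤? m
  ... | yes _   = fm≡h0
  ... | no  m≰m = contradiction ≤-refl m≰m
  join-+ {m} {h = h} (suc t) _ with suc t + m ≤? m
  ... | yes t+m<m = contradiction t+m<m (<⇒≱ (s≤s (m≤n+m m t)))
  ... | no  _     = cong h (m+n∸n≡m (suc t) m)

data Split (m : ℕ) : ℕ → Set where
  before : ∀ {i} → i < m → Split m i
  after  : ∀ t → Split m (t + m)

split : ∀ m i → Split m i
split zero    zero = after 0
split (suc m) zero = before z<s
split m (suc i) with split m i
... | after t    = after (suc t)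
... | before i<m with m≤n⇒m<n∨m≡n i<m
...   | inj₁ 1+i<m = before 1+i<m
...   | inj₂ refl  = after 0

module _ {A : Set} {k : ℕ} {f : ℕ → A} where

  InjectiveUpTo-prefix : ∀ {m} → InjectiveUpTo k f → m ≤ k → InjectiveUpTo m f
  InjectiveUpTo-prefix inj m≤k i≤m j≤m = inj (≤-trans i≤m m≤k) (≤-trans j≤m m≤k)

  InjectiveUpTo-shift : ∀ {s m} → InjectiveUpTo k f → s + m ≤ k → InjectiveUpTo m (λ t → f (s + t))
  InjectiveUpTo-shift {s} inj s+m≤k {i} {j} i≤m j≤m eq =
    +-cancelˡ-≡ s i j (inj (≤-trans (+-monoʳ-≤ s i≤m) s+m≤k) (≤-trans (+-monoʳ-≤ s j≤m) s+m≤k) eq)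

  InjectiveUpTo-reversed : InjectiveUpTo k f → InjectiveUpTo k (reversed k f)
  InjectiveUpTo-reversed inj {i} {j} i≤k j≤k eq = ∸-cancelˡ-≡ i≤k j≤k (inj (m∸n≤m k i) (m∸n≤m k j) eq)

extend-agreement : ∀ {A : Set} {m} {a b : ℕ → A} → (∀ {i} → i ≤ m → a i ≡ b i) → a (suc m) ≡ b (suc m) →
                   ∀ {i} → i ≤ suc m → a i ≡ b i
extend-agreement agree last i≤1+m with m≤n⇒m<n∨m≡n i≤1+m
... | inj₁ i<1+m = agree (≤-pred i<1+m)
... | inj₂ refl  = last

clampTo : ∀ L → ℕ → Fin (suc L)
clampTo L i = fromℕ< (s≤s (m⊓n≤n i L))

toℕ-clampTo : ∀ {L i} → i ≤ L → toℕ (clampTo L i) ≡ i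
toℕ-clampTo {L} {i} i≤L = trans (toℕ-fromℕ< _) (m≤n⇒m⊓n≡m i≤L)

clampTo-toℕ : ∀ {L} (x : Fin (suc L)) → clampTo L (toℕ x) ≡ x
clampTo-toℕ x = toℕ-injective (toℕ-clampTo (toℕ≤pred[n] x))

module _ {n : ℕ} (G : Graph n) where

  Edge : Fin n → Fin n → Set
  Edge u v = adj G u v ≡ true

  Edge-sym : ∀ {u v} → Edge u v → Edge v u
  Edge-sym {u} {v} = trans (Graph.sym G v u)

  IsWalk : ℕ → (ℕ → Fin n) → Set
  IsWalk k f = ∀ i → i < k → Edge (f i) (f (suc i))

  record IsNBWalk (k : ℕ) (f : ℕ → Fin n) : Set where
    constructor nbWalk
    field
      walk            : IsWalk k f
      nonBacktracking : ∀ i → 2 + i ≤ k → f (2 + i) ≢ f i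

  record IsPath (k : ℕ) (f : ℕ → Fin n) : Set where
    constructor path
    field
      walk      : IsWalk k f
      injective : InjectiveUpTo k f

  module _ {k : ℕ} {f : ℕ → Fin n} where

    IsWalk-prefix : ∀ {m} → IsWalk k f → m ≤ k → IsWalk m f
    IsWalk-prefix walk m≤k i i<m = walk i (≤-trans i<m m≤k)

    IsWalk-shift : ∀ {s m} → IsWalk k f → s + m ≤ k → IsWalk m (λ t → f (s + t))
    IsWalk-shift {s} walk s+m≤k i i<m =
      subst (λ j → Edge (f (s + i)) (f j)) (sym (+-suc s i))
            (walk (s + i) (≤-trans (≤-reflexive (sym (+-suc s i))) (≤-trans (+-monoʳ-≤ s i<m) s+m≤k)))

    IsWalk-reversed : IsWalk k f → IsWalk k (reversed k f)
    IsWalk-reversed walk i i<k =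
      subst (λ j → Edge (f j) (f (k ∸ suc i))) (sym k∸i≡1+k∸1+i)
            (Edge-sym (walk (k ∸ suc i) (subst (_≤ k) k∸i≡1+k∸1+i (m∸n≤m k i))))
      where
      k∸i≡1+k∸1+i : k ∸ i ≡ suc (k ∸ suc i)
      k∸i≡1+k∸1+i = +-∸-assoc 1 i<k

    IsPath-prefix : ∀ {m} → IsPath k f → m ≤ k → IsPath m f
    IsPath-prefix (path walk inj) m≤k = path (IsWalk-prefix walk m≤k) (InjectiveUpTo-prefix inj m≤k)

    IsPath-shift : ∀ {s m} → IsPath k f → s + m ≤ k → IsPath m (λ t → f (s + t))
    IsPath-shift (path walk inj) s+m≤k = path (IsWalk-shift walk s+m≤k) (InjectiveUpTo-shift inj s+m≤k)

    IsPath-reversed : IsPath k f → IsPath k (reversed k f)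
    IsPath-reversed (path walk inj) = path (IsWalk-reversed walk) (InjectiveUpTo-reversed inj)

    IsPath⇒IsNBWalk : IsPath k f → IsNBWalk k f
    IsPath⇒IsNBWalk (path walk inj) =
      nbWalk walk (λ i 2+i≤k eq →
        <⇒≢ (m<n+m i z<s) (sym (inj 2+i≤k (≤-trans (m≤n+m i 2) 2+i≤k) eq)))

    IsNBWalk-prefix : ∀ {m} → IsNBWalk k f → m ≤ k → IsNBWalk m f
    IsNBWalk-prefix (nbWalk walk nb) m≤k =
      nbWalk (IsWalk-prefix walk m≤k) (λ i 2+i≤m → nb i (≤-trans 2+i≤m m≤k))

    IsNBWalk-shift : ∀ {s m} → IsNBWalk k f → s + m ≤ k → IsNBWalk m (λ t → f (s + t))
    IsNBWalk-shift {s} (nbWalk walk nb) s+m≤k = nbWalk (IsWalk-shift walk s+m≤k) λ i 2+i≤m eq →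
      nb (s + i) (subst (_≤ k) (s+[2+i]≡2+[s+i] i) (≤-trans (+-monoʳ-≤ s 2+i≤m) s+m≤k))
         (trans (cong f (sym (s+[2+i]≡2+[s+i] i))) eq)
      where
      s+[2+i]≡2+[s+i] : ∀ i → s + (2 + i) ≡ 2 + (s + i)
      s+[2+i]≡2+[s+i] i = trans (+-suc s (suc i)) (cong suc (+-suc s i))

    IsNBWalk-reversed : IsNBWalk k f → IsNBWalk k (reversed k f)
    IsNBWalk-reversed (nbWalk walk nb) = nbWalk (IsWalk-reversed walk) nb′
      where
      nb′ : ∀ i → 2 + i ≤ k → f (k ∸ (2 + i)) ≢ f (k ∸ i)
      nb′ i 2+i≤k eq = nb (k ∸ (2 + i)) (subst (_≤ k) k∸i≡2+k∸2+i (m∸n≤m k i))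
                          (trans (cong f (sym k∸i≡2+k∸2+i)) (sym eq))
        where
        k∸i≡2+k∸2+i : k ∸ i ≡ 2 + (k ∸ (2 + i))
        k∸i≡2+k∸2+i = +-∸-assoc 2 2+i≤k

  IsNBWalk-cong : ∀ {k f h} → (∀ {i} → i ≤ k → f i ≡ h i) → IsNBWalk k f → IsNBWalk k h
  IsNBWalk-cong f≗h (nbWalk walk nb) = nbWalk
    (λ i i<k → subst₂ Edge (f≗h (<⇒≤ i<k)) (f≗h i<k) (walk i i<k))
    (λ i 2+i≤k → subst₂ _≢_ (f≗h 2+i≤k) (f≗h (≤-trans (m≤n+m i 2) 2+i≤k)) (nb i 2+i≤k))

  IsNBWalk-join : ∀ {m k f h} → IsNBWalk (suc m) f → IsNBWalk k h → f (suc m) ≡ h 0 → h 1 ≢ f m →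
                  IsNBWalk (k + suc m) (join (suc m) f h)
  IsNBWalk-join {m} {k} {f} {h} (nbWalk walkf nbf) (nbWalk walkh nbh) meet turn = nbWalk walk nb
    where
    c = join (suc m) f h
    c-left : ∀ {i} → i ≤ suc m → c i ≡ f i
    c-left = join-≤
    c-right : ∀ t → c (t + suc m) ≡ h t
    c-right t = join-+ t meet
    walk : IsWalk (k + suc m) c
    walk i i<len with split (suc m) i
    ... | before i<1+m = subst₂ Edge (sym (c-left (<⇒≤ i<1+m))) (sym (c-left i<1+m))
                                (walkf i i<1+m)
    ... | after t      = subst₂ Edge (sym (c-right t)) (sym (c-right (suc t)))
                                (walkh t (+-cancelʳ-< (suc m) t k i<len))
    nb : ∀ i → 2 + i ≤ k + suc m → c (2 + i) ≢ c i
    nb i 2+i≤len with split (suc m) i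
    ... | after t = subst₂ _≢_ (sym (c-right (2 + t))) (sym (c-right t))
                           (nbh t (+-cancelʳ-≤ (suc m) (2 + t) k 2+i≤len))
    ... | before i<1+m with m≤n⇒m<n∨m≡n (≤-pred i<1+m)
    ...   | inj₁ i<m  = subst₂ _≢_ (sym (c-left (s≤s i<m))) (sym (c-left (<⇒≤ i<1+m))) (nbf i (s≤s i<m))
    ...   | inj₂ refl = subst₂ _≢_ (sym (c-right 1)) (sym (c-left (<⇒≤ i<1+m))) turn

  toGPath : ∀ {k f} → IsPath k f → GPath G k
  toGPath {k} {f} (path walk inj) = record
    { vtx      = λ x → f (toℕ x)
    ; adjacent = λ i → subst (λ j → Edge (f j) (f (suc (toℕ i)))) (sym (toℕ-inject₁ i))
                             (walk (toℕ i) (toℕ<n i))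
    ; distinct = λ {x} {y} eq → toℕ-injective (inj (toℕ≤pred[n] x) (toℕ≤pred[n] y) eq)
    }

  GPath⇒IsPath : ∀ {L} (p : GPath G L) → IsPath L (vtx p ∘ clampTo L)
  GPath⇒IsPath {L} p = path walk λ i≤L j≤L eq →
    trans (sym (toℕ-clampTo i≤L)) (trans (cong toℕ (distinct p eq)) (toℕ-clampTo j≤L))
    where
    walk : IsWalk L (vtx p ∘ clampTo L)
    walk i i<L = subst₂ (λ x y → Edge (vtx p x) (vtx p y))
      (toℕ-injective (trans (toℕ-inject₁ _) (trans (toℕ-fromℕ< i<L) (sym (toℕ-clampTo (<⇒≤ i<L))))))
      (toℕ-injective (trans (cong suc (toℕ-fromℕ< i<L)) (sym (toℕ-clampTo i<L))))
      (adjacent p (fromℕ< i<L))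

  module _ {g : ℕ} (girth : GirthAtLeast G g) where

    girth≤cycle : ∀ {m f} → IsPath m f → 2 ≤ m → Edge (f m) (f 0) → g ≤ suc m
    girth≤cycle {m} {f} p 2≤m closes =
      girth m (toGPath p) (2≤m , subst (λ j → Edge (f j) (f 0)) (sym (toℕ-fromℕ m)) closes)

    IsNBWalk⇒IsPath : ∀ {k f} → k < g → IsNBWalk k f → IsPath k f
    IsNBWalk⇒IsPath {zero} _ nbw =
      path (IsNBWalk.walk nbw) λ i≤0 j≤0 _ → trans (n≤0⇒n≡0 i≤0) (sym (n≤0⇒n≡0 j≤0))
    IsNBWalk⇒IsPath {suc k} {f} 1+k<g nbw@(nbWalk walk nb) = path walk injective
      where
      prefix : IsPath k f
      prefix = IsNBWalk⇒IsPath (<-trans (n<1+n k) 1+k<g) (IsNBWalk-prefix nbw (n≤1+n k))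
      -- A repetition f (1 + k) ≡ f j closes the cycle f j, …, f k of length k + 1 − j.
      fresh : ∀ j o → j + o ≡ k → f (suc k) ≢ f j
      fresh j zero j+0≡k eq = contradiction
        (trans (sym (Graph.irrefl G (f j)))
               (subst₂ Edge (cong f (trans (sym j+0≡k) (+-identityʳ j))) eq
                       (walk k (n<1+n k))))
        λ ()
      fresh j (suc zero) j+1≡k eq = nb j (≤-reflexive (sym 1+k≡2+j)) (trans (cong f (sym 1+k≡2+j)) eq)
        where
        1+k≡2+j : suc k ≡ 2 + j
        1+k≡2+j = cong suc (trans (sym j+1≡k) (+-comm j 1))
      fresh j (suc (suc o)) j+2+o≡k eq = <⇒≱ 1+k<g (≤-trans cycle (s≤s 2+o≤k))
        where
        2+o≤k : 2 + o ≤ k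
        2+o≤k = subst (2 + o ≤_) j+2+o≡k (m≤n+m (2 + o) j)
        cycle : g ≤ suc (2 + o)
        cycle = girth≤cycle (IsPath-shift prefix (≤-reflexive j+2+o≡k)) (s≤s (s≤s z≤n))
                  (subst₂ Edge (cong f (sym j+2+o≡k)) (trans eq (cong f (sym (+-identityʳ j))))
                          (walk k (n<1+n k)))
      fresh-below : ∀ {j} → j < suc k → f (suc k) ≢ f j
      fresh-below j<1+k = fresh _ _ (proj₂ (m≤n⇒∃[o]m+o≡n (≤-pred j<1+k)))
      injective : InjectiveUpTo (suc k) f
      injective i≤ j≤ eq with m≤n⇒m<n∨m≡n i≤ | m≤n⇒m<n∨m≡n j≤
      ... | inj₁ i<1+k | inj₁ j<1+k = IsPath.injective prefix (≤-pred i<1+k) (≤-pred j<1+k) eq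
      ... | inj₂ refl  | inj₂ refl  = refl
      ... | inj₂ refl  | inj₁ j<1+k = contradiction eq (fresh-below j<1+k)
      ... | inj₁ i<1+k | inj₂ refl  = contradiction (sym eq) (fresh-below i<1+k)

    girth≤closedNBWalk : ∀ {k f} → IsNBWalk k f → 2 ≤ k → Edge (f k) (f 0) → g ≤ suc k
    girth≤closedNBWalk {k} nbw 2≤k closes with k <? g
    ... | yes k<g = girth≤cycle (IsNBWalk⇒IsPath k<g nbw) 2≤k closes
    ... | no  k≮g = ≤-trans (≮⇒≥ k≮g) (n≤1+n k)

    -- Going out along a and back along b is a closed non-backtracking walk.
    girth≤diverging : ∀ {m k a b} → IsPath (suc m) a → IsPath (suc k) b → a 0 ≡ b 0 →
                      a (suc m) ≡ b (suc k) → a m ≢ b k → g ≤ suc m + suc k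
    girth≤diverging {m} {k} {a} {b} pa pb start end turn =
      subst (g ≤_) (trans (cong suc (+-comm k (suc m))) (sym (+-suc (suc m) k)))
        (girth≤closedNBWalk c-nonBacktracking (2≤len m k turn) closes)
      where
      c = join (suc m) a (reversed (suc k) b)
      c-nonBacktracking : IsNBWalk (k + suc m) c
      c-nonBacktracking = IsNBWalk-join (IsPath⇒IsNBWalk pa)
        (IsNBWalk-prefix (IsNBWalk-reversed (IsPath⇒IsNBWalk pb)) (n≤1+n k)) end (turn ∘ sym)
      2≤len : ∀ m′ k′ → a m′ ≢ b k′ → 2 ≤ k′ + suc m′
      2≤len (suc m′) k′     _     = ≤-trans (s≤s (s≤s z≤n)) (m≤n+m (suc (suc m′)) k′)
      2≤len zero     (suc k′) _     = s≤s (m≤n+m 1 k′)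
      2≤len zero     zero   turn′ = contradiction start turn′
      closes : Edge (c (k + suc m)) (c 0)
      closes = subst₂ Edge
                      (trans (cong b (sym (m+n∸n≡m 1 k))) (sym (join-+ k end)))
                      (trans (sym start) (sym (join-≤ {m = suc m} {f = a} {h = reversed (suc k) b} z≤n)))
                      (Edge-sym (IsPath.walk pb 0 z<s))

    unique-path : ∀ m {k a b} → IsPath m a → IsPath k b → a 0 ≡ b 0 → a m ≡ b k → m + k < g →
                  m ≡ k × (∀ {i} → i ≤ m → a i ≡ b i)
    unique-path zero {k} {a} {b} pa pb start end _ =
      IsPath.injective pb z≤n ≤-refl (trans (sym start) end) ,
      λ i≤0 → subst (λ i → a i ≡ b i) (sym (n≤0⇒n≡0 i≤0)) start
    unique-path (suc m) {zero} pa pb start end _ =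
      contradiction (IsPath.injective pa ≤-refl z≤n (trans end (sym start))) λ ()
    unique-path (suc m) {suc k} {a} {b} pa pb start end m+k<g with a m ≟ b k
    ... | no  turn = contradiction (girth≤diverging pa pb start end turn) (<⇒≱ m+k<g)
    ... | yes meet with unique-path m (IsPath-prefix pa (n≤1+n m)) (IsPath-prefix pb (n≤1+n k)) start meet
                          (≤-trans (s≤s (+-mono-≤ (n≤1+n m) (n≤1+n k))) m+k<g)
    ...   | refl , agree = refl , extend-agreement agree end

    path-within-path : ∀ {L x y p q} → L + L < g → IsPath L x → IsPath L y → p ≤ q → q ≤ L →
                       y 0 ≡ x p → y L ≡ x q → ∀ {i} → i ≤ L → y i ≡ x i
    path-within-path {L} {x} {y} {p} {q} 2L<g px py p≤q q≤L start end {i} i≤L = begin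
      y i       ≡⟨ proj₂ same i≤L ⟩
      x (p + i) ≡⟨ cong (λ p′ → x (p′ + i)) p≡0 ⟩
      x i       ∎
      where
      open ≡-Reasoning
      p+[q∸p]≡q : p + (q ∸ p) ≡ q
      p+[q∸p]≡q = m+[n∸m]≡n p≤q
      same : L ≡ q ∸ p × (∀ {i} → i ≤ L → y i ≡ x (p + i))
      same = unique-path L py (IsPath-shift px (subst (_≤ L) (sym p+[q∸p]≡q) q≤L))
               (trans start (cong x (sym (+-identityʳ p)))) (trans end (cong x (sym p+[q∸p]≡q)))
               (≤-<-trans (+-monoʳ-≤ L (≤-trans (m∸n≤m q p) q≤L)) 2L<g)
      p≡0 : p ≡ 0
      p≡0 = n≤0⇒n≡0 (+-cancelʳ-≤ L p 0
              (≤-trans (≤-reflexive (trans (cong (p +_) (proj₁ same)) p+[q∸p]≡q)) q≤L))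

module _ {A : Set} where

  steps : List⁺ A → ℕ
  steps w = length (List⁺.tail w)

  -- Positions past the end all read the last entry.
  _‼_ : List⁺ A → ℕ → A
  (x ∷ _)      ‼ zero  = x
  (x ∷ [])     ‼ suc _ = x
  (_ ∷ y ∷ ys) ‼ suc i = (y ∷ ys) ‼ i

  fromFunction : (ℕ → A) → ℕ → List⁺ A
  fromFunction f zero    = f 0 ∷ []
  fromFunction f (suc k) = f 0 ∷⁺ fromFunction (f ∘ suc) k

  steps-fromFunction : ∀ f k → steps (fromFunction f k) ≡ k
  steps-fromFunction f zero    = refl
  steps-fromFunction f (suc k) = cong suc (steps-fromFunction (f ∘ suc) k)

  ‼-fromFunction : ∀ f k {i} → i ≤ k → fromFunction f k ‼ i ≡ f i
  ‼-fromFunction f zero    z≤n               = refl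
  ‼-fromFunction f (suc k) {zero}  _         = refl
  ‼-fromFunction f (suc k) {suc i} (s≤s i≤k) = ‼-fromFunction (f ∘ suc) k i≤k

  ‼-extensionality : ∀ {x y} k → steps x ≡ k → steps y ≡ k → (∀ {i} → i ≤ k → x ‼ i ≡ y ‼ i) → x ≡ y
  ‼-extensionality {_ ∷ []}     {_ ∷ []}     _       _   _   agree = cong (_∷ []) (agree z≤n)
  ‼-extensionality {_ ∷ []}     {_ ∷ _ ∷ _}  _       x≡k y≡k _     = contradiction (trans y≡k (sym x≡k)) λ ()
  ‼-extensionality {_ ∷ _ ∷ _}  {_ ∷ []}     _       x≡k y≡k _     = contradiction (trans x≡k (sym y≡k)) λ ()
  ‼-extensionality {_ ∷ _ ∷ _}  {_ ∷ _ ∷ _}  zero    ()  _   _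
  ‼-extensionality {_ ∷ _ ∷ _}  {_ ∷ _ ∷ _}  (suc k) x≡k y≡k agree =
    cong₂ (λ c cs → c ∷ List⁺.toList cs) (agree z≤n)
          (‼-extensionality k (suc-injective x≡k) (suc-injective y≡k) (λ i≤k → agree (s≤s i≤k)))

  backwards : List⁺ A → List⁺ A
  backwards w = fromFunction (reversed (steps w) (w ‼_)) (steps w)

  steps-backwards : ∀ w → steps (backwards w) ≡ steps w
  steps-backwards w = steps-fromFunction _ (steps w)

  ‼-backwards : ∀ w {i} → i ≤ steps w → backwards w ‼ i ≡ w ‼ (steps w ∸ i)
  ‼-backwards w = ‼-fromFunction _ (steps w)

  backwards-involutive : ∀ w → backwards (backwards w) ≡ w
  backwards-involutive w =
    ‼-extensionality (steps w) (trans (steps-backwards (backwards w)) (steps-backwards w)) refl λ {i} i≤ → begin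
      backwards (backwards w) ‼ i
        ≡⟨ ‼-backwards (backwards w) (subst (i ≤_) (sym (steps-backwards w)) i≤) ⟩
      backwards w ‼ (steps (backwards w) ∸ i)
        ≡⟨ cong (λ s → backwards w ‼ (s ∸ i)) (steps-backwards w) ⟩
      backwards w ‼ (steps w ∸ i)
        ≡⟨ ‼-backwards w (m∸n≤m (steps w) i) ⟩
      w ‼ (steps w ∸ (steps w ∸ i))
        ≡⟨ cong (w ‼_) (m∸[m∸n]≡n i≤) ⟩
      w ‼ i
        ∎
    where open ≡-Reasoning

  backwards-‼-first : ∀ w → backwards w ‼ 0 ≡ w ‼ steps w
  backwards-‼-first w = ‼-backwards w z≤n

  backwards-‼-last : ∀ w → backwards w ‼ steps (backwards w) ≡ w ‼ 0
  backwards-‼-last w = trans (cong (backwards w ‼_) (steps-backwards w))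
                             (trans (‼-backwards w ≤-refl) (cong (w ‼_) (n∸n≡0 (steps w))))

module _ {n : ℕ} where

  -- Each path is counted once, in the orientation whose first end has the smaller index.
  Ascending : List⁺ (Fin n) → Set
  Ascending w = toℕ (w ‼ 0) < toℕ (w ‼ steps w)

  ascending? : Decidable Ascending
  ascending? w = toℕ (w ‼ 0) <? toℕ (w ‼ steps w)

  Ascending-backwards : ∀ {w} → Ascending w → ¬ Ascending (backwards w)
  Ascending-backwards {w} asc asc′ =
    <-asym asc (subst₂ (λ a b → toℕ a < toℕ b) (backwards-‼-first w) (backwards-‼-last w) asc′)

  ¬Ascending-backwards : ∀ {w} → w ‼ steps w ≢ w ‼ 0 → ¬ Ascending w → Ascending (backwards w)
  ¬Ascending-backwards {w} ends-differ ¬asc =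
    subst₂ (λ a b → toℕ a < toℕ b) (sym (backwards-‼-first w)) (sym (backwards-‼-last w))
           (≤∧≢⇒< (≮⇒≥ ¬asc) (ends-differ ∘ toℕ-injective))

module _ {n : ℕ} (G : Graph n) where

  NBWalk : List⁺ (Fin n) → Set
  NBWalk w = IsNBWalk G (steps w) (w ‼_)

  NBWalk-[] : ∀ v → NBWalk [ v ]
  NBWalk-[] v = nbWalk (λ _ ()) (λ _ ())

  NBWalk-fromFunction : ∀ {k f} → IsNBWalk G k f → NBWalk (fromFunction f k)
  NBWalk-fromFunction {k} {f} nbw =
    subst (λ s → IsNBWalk G s (fromFunction f k ‼_)) (sym (steps-fromFunction f k))
          (IsNBWalk-cong G (λ i≤k → sym (‼-fromFunction f k i≤k)) nbw)

  NBWalk-backwards : ∀ {w} → NBWalk w → NBWalk (backwards w)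
  NBWalk-backwards nbw = NBWalk-fromFunction (IsNBWalk-reversed G nbw)

  toWalk : ∀ {L} → GPath G L → List⁺ (Fin n)
  toWalk {L} p = fromFunction (vtx p ∘ clampTo L) L

  steps-toWalk : ∀ {L} (p : GPath G L) → steps (toWalk p) ≡ L
  steps-toWalk {L} p = steps-fromFunction _ L

  ‼-toWalk : ∀ {L} (p : GPath G L) (x : Fin (suc L)) → toWalk p ‼ toℕ x ≡ vtx p x
  ‼-toWalk {L} p x = trans (‼-fromFunction _ L (toℕ≤pred[n] x)) (cong (vtx p) (clampTo-toℕ x))

  NBWalk-toWalk : ∀ {L} (p : GPath G L) → NBWalk (toWalk p)
  NBWalk-toWalk p = NBWalk-fromFunction (IsPath⇒IsNBWalk G (GPath⇒IsPath G p))

  neighbours : Fin n → List (Fin n)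
  neighbours u = filter (T? ∘ adj G u) (allFin n)

  ∈-neighbours⁺ : ∀ {u v} → Edge G u v → v ∈ neighbours u
  ∈-neighbours⁺ {v = v} uv = ∈-filter⁺ (T? ∘ adj G _) (∈-allFin v) (Equivalence.from T-≡ uv)

  ∈-neighbours⁻ : ∀ {u v} → v ∈ neighbours u → Edge G u v
  ∈-neighbours⁻ v∈ = Equivalence.to T-≡ (proj₂ (∈-filter⁻ (T? ∘ adj G _) {xs = allFin n} v∈))

  neighbours-unique : ∀ u → Unique (neighbours u)
  neighbours-unique u = filter⁺ (T? ∘ adj G u) (allFin⁺ n)

  successors : List⁺ (Fin n) → List (Fin n)
  successors (u ∷ [])    = neighbours u
  successors (u ∷ v ∷ _) = filter (λ x → ¬? (x ≟ v)) (neighbours u)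

  successors-unique : ∀ w → Unique (successors w)
  successors-unique (u ∷ [])    = neighbours-unique u
  successors-unique (u ∷ v ∷ _) = filter⁺ (λ x → ¬? (x ≟ v)) (neighbours-unique u)

  ∈-successors⁺ : ∀ {w u} → Edge G (w ‼ 0) u → (1 ≤ steps w → u ≢ w ‼ 1) → u ∈ successors w
  ∈-successors⁺ {_ ∷ []}    adjacent _    = ∈-neighbours⁺ adjacent
  ∈-successors⁺ {_ ∷ _ ∷ _} adjacent turn =
    ∈-filter⁺ (λ x → ¬? (x ≟ _)) (∈-neighbours⁺ adjacent) (turn (s≤s z≤n))

  successor-adjacent : ∀ {w u} → u ∈ successors w → Edge G (w ‼ 0) u
  successor-adjacent {_ ∷ []}    u∈ = ∈-neighbours⁻ u∈
  successor-adjacent {h ∷ _ ∷ _} u∈ =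
    ∈-neighbours⁻ (proj₁ (∈-filter⁻ (λ x → ¬? (x ≟ _)) {xs = neighbours h} u∈))

  successor-turns : ∀ {w u} → u ∈ successors w → 1 ≤ steps w → u ≢ w ‼ 1
  successor-turns {h ∷ _ ∷ _} u∈ _ = proj₂ (∈-filter⁻ (λ x → ¬? (x ≟ _)) {xs = neighbours h} u∈)

  NBWalk-∷⁺ : ∀ {w u} → NBWalk w → u ∈ successors w → NBWalk (u ∷⁺ w)
  NBWalk-∷⁺ {w} {u} (nbWalk walk nb) u∈ = nbWalk walk′ nb′
    where
    walk′ : IsWalk G (suc (steps w)) ((u ∷⁺ w) ‼_)
    walk′ zero    _         = Edge-sym G (successor-adjacent {w} u∈)
    walk′ (suc i) (s≤s i<k) = walk i i<k
    nb′ : ∀ i → 2 + i ≤ suc (steps w) → (u ∷⁺ w) ‼ (2 + i) ≢ (u ∷⁺ w) ‼ i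
    nb′ zero    (s≤s 1≤k)   = successor-turns {w} u∈ 1≤k ∘ sym
    nb′ (suc i) (s≤s 2+i≤k) = nb i 2+i≤k

  extensions : ℕ → List⁺ (Fin n) → List (List⁺ (Fin n))
  extensions zero    w = w ∷ []
  extensions (suc k) w = concatMap (λ u → extensions k (u ∷⁺ w)) (successors w)

  ∈-extensions-suc⁻ : ∀ {k w x} → x ∈ extensions (suc k) w →
                      ∃ λ u → u ∈ successors w × x ∈ extensions k (u ∷⁺ w)
  ∈-extensions-suc⁻ {k} {w} x∈ =
    find (∈-concatMap⁻ (λ u → extensions k (u ∷⁺ w)) {xs = successors w} x∈)

  extensions-steps : ∀ k {w x} → x ∈ extensions k w → steps x ≡ k + steps w
  extensions-steps zero    (here refl) = refl
  extensions-steps (suc k) {w} x∈ with ∈-extensions-suc⁻ {k} {w} x∈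
  ... | u , _ , x∈′ = trans (extensions-steps k x∈′) (+-suc k (steps w))

  extensions-suffix : ∀ k {w x} → x ∈ extensions k w → ∀ {i} → i ≤ steps w → x ‼ (k + i) ≡ w ‼ i
  extensions-suffix zero    (here refl) _ = refl
  extensions-suffix (suc k) {w} {x} x∈ {i} i≤ with ∈-extensions-suc⁻ {k} {w} x∈
  ... | u , _ , x∈′ = trans (cong (x ‼_) (sym (+-suc k i))) (extensions-suffix k x∈′ (s≤s i≤))

  extensions-NBWalk : ∀ k {w x} → NBWalk w → x ∈ extensions k w → NBWalk x
  extensions-NBWalk zero    nbw (here refl) = nbw
  extensions-NBWalk (suc k) {w} nbw x∈ with ∈-extensions-suc⁻ {k} {w} x∈
  ... | u , u∈ , x∈′ = extensions-NBWalk k (NBWalk-∷⁺ nbw u∈) x∈′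

  extensions-unique : ∀ k w → Unique (extensions k w)
  extensions-unique zero    w = [] ∷ []
  extensions-unique (suc k) w =
    concatMap⁺ (λ u → extensions k (u ∷⁺ w)) (λ u → extensions-unique k (u ∷⁺ w))
      (λ x∈ x∈′ → trans (sym (extensions-suffix k x∈ z≤n)) (extensions-suffix k x∈′ z≤n))
      (successors-unique w)

  ∈-extensions : ∀ k {w x} → NBWalk x → steps x ≡ k + steps w →
                 (∀ {i} → i ≤ steps w → x ‼ (k + i) ≡ w ‼ i) → x ∈ extensions k w
  ∈-extensions zero    {w} {x} _ x≡w agree = here (‼-extensionality (steps w) x≡w refl agree)
  ∈-extensions (suc k) {w} {x} nbw@(nbWalk walk nb) steps-x suffix =
    ∈-concatMap⁺ (λ u → extensions k (u ∷⁺ w)) (lose u∈ x∈)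
    where
    u = x ‼ k
    k<steps : k < steps x
    k<steps = subst (k <_) (sym steps-x) (s≤s (m≤m+n k (steps w)))
    next≡head : x ‼ suc k ≡ w ‼ 0
    next≡head = trans (cong (x ‼_) (cong suc (sym (+-identityʳ k)))) (suffix z≤n)
    u∈ : u ∈ successors w
    u∈ = ∈-successors⁺ {w} (Edge-sym G (subst (λ v → Edge G u v) next≡head (walk k k<steps)))
           λ 1≤steps eq → nb k (subst (2 + k ≤_) (sym steps-x)
                                (≤-trans (≤-reflexive (cong suc (+-comm 1 k))) (+-monoʳ-≤ (suc k) 1≤steps)))
                              (trans (cong (x ‼_) (cong suc (+-comm 1 k))) (trans (suffix 1≤steps) (sym eq)))
    x∈ : x ∈ extensions k (u ∷⁺ w)
    x∈ = ∈-extensions k nbw (trans steps-x (sym (+-suc k (steps w)))) agree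
      where
      agree : ∀ {i} → i ≤ suc (steps w) → x ‼ (k + i) ≡ (u ∷⁺ w) ‼ i
      agree {zero}  _         = cong (x ‼_) (+-identityʳ k)
      agree {suc i} (s≤s i≤) = trans (cong (x ‼_) (+-suc k i)) (suffix i≤)

  NBWalks : ℕ → List (List⁺ (Fin n))
  NBWalks L = concatMap (λ v → extensions L [ v ]) (allFin n)

  ∈-NBWalks⁻ : ∀ {L x} → x ∈ NBWalks L → NBWalk x × steps x ≡ L
  ∈-NBWalks⁻ {L} x∈ with find (∈-concatMap⁻ (λ v → extensions L [ v ]) {xs = allFin n} x∈)
  ... | v , _ , x∈′ =
    extensions-NBWalk L (NBWalk-[] v) x∈′ , trans (extensions-steps L x∈′) (+-identityʳ L)

  ∈-NBWalks⁺ : ∀ {L x} → NBWalk x → steps x ≡ L → x ∈ NBWalks L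
  ∈-NBWalks⁺ {L} {x} nbw refl = ∈-concatMap⁺ (λ v → extensions L [ v ]) (lose (∈-allFin (x ‼ L))
    (∈-extensions L nbw (sym (+-identityʳ L)) λ { z≤n → cong (x ‼_) (+-identityʳ L) }))

  NBWalks-unique : ∀ L → Unique (NBWalks L)
  NBWalks-unique L = concatMap⁺ (λ v → extensions L [ v ]) (λ v → extensions-unique L [ v ])
    (λ x∈ x∈′ → trans (sym (extensions-suffix L x∈ z≤n)) (extensions-suffix L x∈′ z≤n))
    (allFin⁺ n)

  NBWalks-backwards : ∀ {L x} → x ∈ NBWalks L → backwards x ∈ NBWalks L
  NBWalks-backwards {L} {x} x∈ with ∈-NBWalks⁻ {L} x∈
  ... | nbx , steps-x = ∈-NBWalks⁺ (NBWalk-backwards nbx) (trans (steps-backwards x) steps-x)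

  NBWalksThrough : Fin n → ℕ → ℕ → List (List⁺ (Fin n))
  NBWalksThrough v p q = concatMap (λ b → extensions p (backwards b)) (extensions q [ v ])

  ∈-NBWalksThrough : ∀ {v p q x} → NBWalk x → steps x ≡ p + q → x ‼ p ≡ v → x ∈ NBWalksThrough v p q
  ∈-NBWalksThrough {v} {p} {q} {x} nbw steps-x x‼p≡v =
    ∈-concatMap⁺ (λ b → extensions p (backwards b))
      (lose b∈ (subst (λ c → x ∈ extensions p c) (sym (backwards-involutive remainder)) x∈))
    where
    remainder : List⁺ (Fin n)
    remainder = fromFunction (λ i → x ‼ (p + i)) q
    steps-remainder : steps remainder ≡ q
    steps-remainder = steps-fromFunction _ q
    x∈ : x ∈ extensions p remainder
    x∈ = ∈-extensions p nbw (trans steps-x (cong (p +_) (sym steps-remainder)))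
           λ i≤ → sym (‼-fromFunction _ q (subst (_ ≤_) steps-remainder i≤))
    b∈ : backwards remainder ∈ extensions q [ v ]
    b∈ = ∈-extensions q
           (NBWalk-backwards (NBWalk-fromFunction (IsNBWalk-shift G nbw (≤-reflexive (sym steps-x)))))
           (trans (trans (steps-backwards remainder) steps-remainder) (sym (+-identityʳ q)))
           λ { z≤n → begin
             backwards remainder ‼ (q + 0)      ≡⟨ cong (backwards remainder ‼_) (+-identityʳ q) ⟩
             backwards remainder ‼ q            ≡⟨ ‼-backwards remainder (≤-reflexive (sym steps-remainder)) ⟩
             remainder ‼ (steps remainder ∸ q)  ≡⟨ cong (λ s → remainder ‼ (s ∸ q)) steps-remainder ⟩
             remainder ‼ (q ∸ q)                ≡⟨ cong (remainder ‼_) (n∸n≡0 q) ⟩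
             remainder ‼ 0                      ≡⟨ ‼-fromFunction _ q z≤n ⟩
             x ‼ (p + 0)                        ≡⟨ cong (x ‼_) (+-identityʳ p) ⟩
             x ‼ p                              ≡⟨ x‼p≡v ⟩
             v                                  ∎ }
      where open ≡-Reasoning

module _ {n : ℕ} (G : Graph n) {d : ℕ} (regular : Regular G d) where

  length-neighbours : ∀ u → length (neighbours G u) ≡ d
  length-neighbours u = trans (length-filter-T (adj G u) (allFin n)) (regular u)

  length-successors : ∀ {w} → NBWalk G w → 1 ≤ steps w → length (successors G w) ≡ d ∸ 1
  length-successors {u ∷ _ ∷ _} nbw _ = cong (_∸ 1) (trans
    (length-filter-≢ _≟_ (neighbours-unique G u) (∈-neighbours⁺ G (IsNBWalk.walk nbw 0 z<s)))
    (length-neighbours u))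

  length-extensions : ∀ k {w} → NBWalk G w → 1 ≤ steps w → length (extensions G k w) ≡ (d ∸ 1) ^ k
  length-extensions zero    _   _   = refl
  length-extensions (suc k) {w} nbw 1≤steps = trans
    (length-concatMap (λ u → extensions G k (u ∷⁺ w)) (successors G w)
                      (λ u∈ → length-extensions k (NBWalk-∷⁺ G nbw u∈) (s≤s z≤n)))
    (cong (_* (d ∸ 1) ^ k) (length-successors nbw 1≤steps))

  length-extensions-[] : ∀ k v → length (extensions G (suc k) [ v ]) ≡ d * (d ∸ 1) ^ k
  length-extensions-[] k v = trans
    (length-concatMap (λ u → extensions G k (u ∷⁺ [ v ])) (neighbours G v)
                      (λ u∈ → length-extensions k (NBWalk-∷⁺ G (NBWalk-[] G v) u∈) (s≤s z≤n)))
    (cong (_* (d ∸ 1) ^ k) (length-neighbours v))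

  length-NBWalks : ∀ {L} → 1 ≤ L → length (NBWalks G L) ≡ n * (d * (d ∸ 1) ^ (L ∸ 1))
  length-NBWalks {suc L} _ = trans
    (length-concatMap (λ v → extensions G (suc L) [ v ]) (allFin n) (λ {v} _ → length-extensions-[] L v))
    (cong (_* (d * (d ∸ 1) ^ L)) (length-tabulate {n = n} (λ i → i)))

  length-NBWalksThrough : ∀ v p q → 1 ≤ p + q → length (NBWalksThrough G v p q) ≡ d * (d ∸ 1) ^ (p + q ∸ 1)
  length-NBWalksThrough v (suc p) zero _ = begin
    length (extensions G (suc p) [ v ] ++ [])   ≡⟨ cong length (++-identityʳ (extensions G (suc p) [ v ])) ⟩
    length (extensions G (suc p) [ v ])         ≡⟨ length-extensions-[] p v ⟩
    d * (d ∸ 1) ^ p                             ≡⟨ cong (λ e → d * (d ∸ 1) ^ e) (+-identityʳ p) ⟨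
    d * (d ∸ 1) ^ (p + 0)                       ∎
    where open ≡-Reasoning
  length-NBWalksThrough v p (suc q) _ = begin
    length (NBWalksThrough G v p (suc q))
      ≡⟨ length-concatMap (λ b → extensions G p (backwards b)) (extensions G (suc q) [ v ]) inner ⟩
    length (extensions G (suc q) [ v ]) * (d ∸ 1) ^ p
      ≡⟨ cong (_* (d ∸ 1) ^ p) (length-extensions-[] q v) ⟩
    d * (d ∸ 1) ^ q * (d ∸ 1) ^ p
      ≡⟨ *-assoc d _ _ ⟩
    d * ((d ∸ 1) ^ q * (d ∸ 1) ^ p)
      ≡⟨ cong (d *_) (^-distribˡ-+-* (d ∸ 1) q p) ⟨
    d * (d ∸ 1) ^ (q + p)
      ≡⟨ cong (λ e → d * (d ∸ 1) ^ e) (trans (+-comm q p) (sym (cong (_∸ 1) (+-suc p q)))) ⟩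
    d * (d ∸ 1) ^ (p + suc q ∸ 1)
      ∎
    where
    open ≡-Reasoning
    inner : ∀ {b} → b ∈ extensions G (suc q) [ v ] → length (extensions G p (backwards b)) ≡ (d ∸ 1) ^ p
    inner {b} b∈ = length-extensions p (NBWalk-backwards G (extensions-NBWalk G (suc q) {[ v ]} (NBWalk-[] G v) b∈))
      (subst (1 ≤_) (sym steps-b) (s≤s z≤n))
      where
      steps-b : steps (backwards b) ≡ suc q
      steps-b = trans (steps-backwards b) (trans (extensions-steps G (suc q) {[ v ]} b∈) (+-identityʳ (suc q)))

toℕ-stepIndex : ∀ l r j → toℕ (stepIndex l r j) ≡ toℕ j * r
toℕ-stepIndex l r j = toℕ-fromℕ< _

stepIndex≤ : ∀ l r (j : Fin (suc l)) → toℕ j * r ≤ l * r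
stepIndex≤ l r j = *-monoˡ-≤ r (toℕ≤pred[n] j)

module _ {n : ℕ} (l r : ℕ) where

  choices : List⁺ (Fin n) → Subset n
  choices w = tabulate (λ v → any (λ j → ⌊ w ‼ toℕ (stepIndex l r j) ≟ v ⌋) (allFin (suc l)))

  ∈-choices⁻ : ∀ {w v} → v ∈ₛ choices w → ∃ λ j → w ‼ (toℕ j * r) ≡ v
  ∈-choices⁻ {w} {v} v∈ with find (any⁻ _ (allFin (suc l)) (Equivalence.from T-≡
    (trans (sym (lookup∘tabulate _ v)) ([]=⇒lookup v∈))))
  ... | j , _ , chosen = j , trans (cong (w ‼_) (sym (toℕ-stepIndex l r j))) (toWitness chosen)

  ∈-choices⁺ : ∀ {w v} j → w ‼ (toℕ j * r) ≡ v → v ∈ₛ choices w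
  ∈-choices⁺ {w} {v} j chosen = lookup⇒[]= v _ (trans (lookup∘tabulate _ v) (Equivalence.to T-≡
    (any⁺ _ (lose (∈-allFin j) (fromWitness (trans (cong (w ‼_) (toℕ-stepIndex l r j)) chosen))))))

  choices-⊆ : ∀ {x y} → (∀ j → ∃ λ j′ → x ‼ (toℕ j * r) ≡ y ‼ (toℕ j′ * r)) → choices x ⊆ choices y
  choices-⊆ {x} {y} moves v∈ with ∈-choices⁻ {x} v∈
  ... | j , chosen with moves j
  ...   | j′ , same = ∈-choices⁺ {y} j′ (trans (sym same) chosen)

  choices-backwards : ∀ {w} → steps w ≡ l * r → choices (backwards w) ≡ choices w
  choices-backwards {w} steps-w =
    ⊆-antisym (choices-⊆ (λ j → opposite j , forth j)) (choices-⊆ (λ j → opposite j , back j))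
    where
    L = l * r
    ‼-backwards-L : ∀ {i} → i ≤ L → backwards w ‼ i ≡ w ‼ (L ∸ i)
    ‼-backwards-L {i} i≤L =
      trans (‼-backwards w (subst (i ≤_) (sym steps-w) i≤L)) (cong (λ s → w ‼ (s ∸ i)) steps-w)
    opposite-step : ∀ j → toℕ (opposite j) * r ≡ L ∸ toℕ j * r
    opposite-step j = trans (cong (_* r) (opposite-prop j)) (*-distribʳ-∸ r l (toℕ j))
    forth : ∀ j → backwards w ‼ (toℕ j * r) ≡ w ‼ (toℕ (opposite j) * r)
    forth j = trans (‼-backwards-L (stepIndex≤ l r j)) (cong (w ‼_) (sym (opposite-step j)))
    back : ∀ j → w ‼ (toℕ j * r) ≡ backwards w ‼ (toℕ (opposite j) * r)
    back j = begin
      w ‼ (toℕ j * r)                      ≡⟨ cong (w ‼_) (m∸[m∸n]≡n (stepIndex≤ l r j)) ⟨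
      w ‼ (L ∸ (L ∸ toℕ j * r))            ≡⟨ ‼-backwards-L (m∸n≤m L (toℕ j * r)) ⟨
      backwards w ‼ (L ∸ toℕ j * r)        ≡⟨ cong (backwards w ‼_) (opposite-step j) ⟨
      backwards w ‼ (toℕ (opposite j) * r) ∎
      where open ≡-Reasoning

module _ {n : ℕ} (G : Graph n) {g : ℕ} (girth : GirthAtLeast G g) where

  NBWalk⇒IsPath : ∀ {L w} → L < g → NBWalk G w → steps w ≡ L → IsPath G L (w ‼_)
  NBWalk⇒IsPath L<g nbw refl = IsNBWalk⇒IsPath G girth L<g nbw

  NBWalk-ends-differ : ∀ {L w} → L < g → 1 ≤ L → NBWalk G w → steps w ≡ L → w ‼ steps w ≢ w ‼ 0
  NBWalk-ends-differ L<g 1≤L nbw steps-w eq = <⇒≢ 1≤L (sym (trans (sym steps-w)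
    (IsPath.injective (NBWalk⇒IsPath L<g nbw steps-w) (≤-reflexive steps-w) z≤n eq)))

  NBWalk-within : ∀ {L x y p q} → L + L < g → NBWalk G x → NBWalk G y → steps x ≡ L → steps y ≡ L →
                  p ≤ L → q ≤ L → y ‼ 0 ≡ x ‼ p → y ‼ L ≡ x ‼ q → y ≡ x ⊎ y ≡ backwards x
  NBWalk-within {L} {x} {y} {p} {q} 2L<g nbx nby steps-x steps-y p≤L q≤L start end = within (≤-total p q)
    where
    L<g = ≤-<-trans (m≤m+n L L) 2L<g
    px = NBWalk⇒IsPath L<g nbx steps-x
    py = NBWalk⇒IsPath L<g nby steps-y
    within : p ≤ q ⊎ q ≤ p → y ≡ x ⊎ y ≡ backwards x
    within (inj₁ p≤q) = inj₁ (‼-extensionality L steps-y steps-x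
      (path-within-path G girth 2L<g px py p≤q q≤L start end))
    within (inj₂ q≤p) = inj₂ (‼-extensionality L steps-y (trans (steps-backwards x) steps-x) λ {i} i≤L → begin
      y ‼ i                   ≡⟨ path-within-path G girth 2L<g (IsPath-reversed G px) py
                                   (∸-monoʳ-≤ L q≤p) (m∸n≤m L q)
                                   (trans start (cong (x ‼_) (sym (m∸[m∸n]≡n p≤L))))
                                   (trans end (cong (x ‼_) (sym (m∸[m∸n]≡n q≤L)))) i≤L ⟩
      x ‼ (L ∸ i)             ≡⟨ cong (λ s → x ‼ (s ∸ i)) steps-x ⟨
      x ‼ (steps x ∸ i)       ≡⟨ ‼-backwards x (subst (i ≤_) (sym steps-x) i≤L) ⟨
      backwards x ‼ i         ∎)
      where open ≡-Reasoning

module _ {n : ℕ} (G : Graph n) (l r : ℕ) where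

  potentialChoices-toWalk : (p : GPath G (l * r)) → potentialChoices l r p ≡ choices l r (toWalk G p)
  potentialChoices-toWalk p = tabulate-cong λ v → cong or (map-cong
    (λ j → cong (λ u → ⌊ u ≟ v ⌋) (sym (‼-toWalk G p (stepIndex l r j)))) (allFin (suc l)))

  IsVertex⇒choices : ∀ {S} → IsVertex G l r S → ∃ λ w → NBWalk G w × steps w ≡ l * r × choices l r w ≡ S
  IsVertex⇒choices (p , refl) = toWalk G p , NBWalk-toWalk G p , steps-toWalk G p , sym (potentialChoices-toWalk p)

  ascendingWalks : List (List⁺ (Fin n))
  ascendingWalks = filter ascending? (NBWalks G (l * r))

  ∈-ascendingWalks⁻ : ∀ {w} → w ∈ ascendingWalks → (NBWalk G w × steps w ≡ l * r) × Ascending w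
  ∈-ascendingWalks⁻ w∈ with ∈-filter⁻ ascending? {xs = NBWalks G (l * r)} w∈
  ... | w∈walks , asc = ∈-NBWalks⁻ G {l * r} w∈walks , asc

  choicesThrough : List⁺ (Fin n) → Fin (suc l) → Fin (suc l) → List (Subset n)
  choicesThrough x j i =
    map (choices l r) (NBWalksThrough G (x ‼ (toℕ j * r)) (toℕ i * r) (l * r ∸ toℕ i * r))

  candidateNeighbours : List⁺ (Fin n) → List (Subset n)
  candidateNeighbours x = concatMap (λ j → concatMap (choicesThrough x j) (allFin (suc l))) (allFin (suc l))

  ∈-candidateNeighbours : ∀ {x y v} → NBWalk G y → steps y ≡ l * r →
                          v ∈ₛ choices l r x × v ∈ₛ choices l r y → choices l r y ∈ candidateNeighbours x
  ∈-candidateNeighbours {x} {y} nby steps-y (v∈x , v∈y) with ∈-choices⁻ l r {x} v∈x | ∈-choices⁻ l r {y} v∈y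
  ... | j , xj≡v | i , yi≡v =
    ∈-concatMap⁺ (λ j → concatMap (choicesThrough x j) (allFin (suc l))) (lose (∈-allFin j)
      (∈-concatMap⁺ (choicesThrough x j) (lose (∈-allFin i) (∈-map⁺ (choices l r)
        (∈-NBWalksThrough G {x ‼ (toℕ j * r)} {toℕ i * r} {l * r ∸ toℕ i * r} nby
          (trans steps-y (sym (m+[n∸m]≡n (stepIndex≤ l r i)))) (trans yi≡v (sym xj≡v)))))))

  module _ {g : ℕ} (girth : GirthAtLeast G g) where

    choices⇒IsVertex : ∀ {w} → l * r < g → NBWalk G w → steps w ≡ l * r → IsVertex G l r (choices l r w)
    choices⇒IsVertex L<g nbw steps-w = toGPath G (NBWalk⇒IsPath G girth L<g nbw steps-w) , refl

    choices-injective : ∀ {x y} → l * r + l * r < g → NBWalk G x → NBWalk G y →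
                        steps x ≡ l * r → steps y ≡ l * r →
                        choices l r x ≡ choices l r y → y ≡ x ⊎ y ≡ backwards x
    choices-injective {x} {y} 2L<g nbx nby steps-x steps-y same
      with ∈-choices⁻ l r {x} (subst (y ‼ 0 ∈ₛ_) (sym same) (∈-choices⁺ l r {y} Fin.zero refl))
         | ∈-choices⁻ l r {x} (subst (y ‼ (l * r) ∈ₛ_) (sym same)
                                 (∈-choices⁺ l r {y} (fromℕ l) (cong (λ k → y ‼ (k * r)) (toℕ-fromℕ l))))
    ... | a , xa≡y₀ | b , xb≡yL =
      NBWalk-within G girth 2L<g nbx nby steps-x steps-y
        (stepIndex≤ l r a) (stepIndex≤ l r b) (sym xa≡y₀) (sym xb≡yL)

    length-NBWalks-halves : l * r < g → 1 ≤ l * r → length (NBWalks G (l * r)) ≡ length ascendingWalks * 2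
    length-NBWalks-halves L<g 1≤L =
      length-filter-involution ascending? backwards (NBWalks-unique G (l * r)) (NBWalks-backwards G {l * r})
        (λ {w} _ → backwards-involutive w) (λ {w} _ → Ascending-backwards {w = w}) ¬ascending⇒backwards
      where
      ¬ascending⇒backwards : ∀ {w} → w ∈ NBWalks G (l * r) → ¬ Ascending w → Ascending (backwards w)
      ¬ascending⇒backwards {w} w∈ with ∈-NBWalks⁻ G {l * r} w∈
      ... | nbw , steps-w = ¬Ascending-backwards {w = w} (NBWalk-ends-differ G girth L<g 1≤L nbw steps-w)

    choices-ascendingWalks-unique : l * r + l * r < g → Unique (map (choices l r) ascendingWalks)
    choices-ascendingWalks-unique 2L<g =
      map⁺ (choices l r) injective (filter⁺ ascending? (NBWalks-unique G (l * r)))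
      where
      injective : ∀ {x y} → x ∈ ascendingWalks → y ∈ ascendingWalks → choices l r x ≡ choices l r y → x ≡ y
      injective {x} x∈ y∈ same with ∈-ascendingWalks⁻ x∈ | ∈-ascendingWalks⁻ y∈
      ... | (nbx , steps-x) , asc-x | (nby , steps-y) , asc-y
        with choices-injective 2L<g nbx nby steps-x steps-y same
      ...   | inj₁ y≡x          = sym y≡x
      ...   | inj₂ y≡backwards =
        contradiction (subst Ascending y≡backwards asc-y) (Ascending-backwards {w = x} asc-x)

    IsVertex⇒∈choices-ascendingWalks : l * r < g → 1 ≤ l * r →
      ∀ {S} → IsVertex G l r S → S ∈ map (choices l r) ascendingWalks
    IsVertex⇒∈choices-ascendingWalks L<g 1≤L isVertex with IsVertex⇒choices isVertex
    ... | w , nbw , steps-w , refl with ascending? w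
    ...   | yes asc = ∈-map⁺ (choices l r) (∈-filter⁺ ascending? w∈ asc)
      where w∈ = ∈-NBWalks⁺ G nbw steps-w
    ...   | no ¬asc = subst (_∈ map (choices l r) ascendingWalks) (choices-backwards l r steps-w)
      (∈-map⁺ (choices l r) (∈-filter⁺ ascending? (NBWalks-backwards G {l * r} w∈)
        (¬Ascending-backwards {w = w} (NBWalk-ends-differ G girth L<g 1≤L nbw steps-w) ¬asc)))
      where w∈ = ∈-NBWalks⁺ G nbw steps-w

    ∈choices-ascendingWalks⇒IsVertex : l * r < g →
      ∀ {S} → S ∈ map (choices l r) ascendingWalks → IsVertex G l r S
    ∈choices-ascendingWalks⇒IsVertex L<g S∈ with ∈-map⁻ (choices l r) S∈
    ... | w , w∈ , refl with ∈-ascendingWalks⁻ w∈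
    ...   | (nbw , steps-w) , _ = choices⇒IsVertex L<g nbw steps-w

module _ {n : ℕ} (G : Graph n) {d : ℕ} (regular : Regular G d) (l r : ℕ) where

  vertexCount : ∀ {g} → GirthAtLeast G g → l * r + l * r < g → 1 ≤ l * r →
                VertexCount G l r ((n * d * (d ∸ 1) ^ (l * r ∸ 1)) / 2)
  vertexCount girth 2L<g 1≤L =
    map (choices l r) (ascendingWalks G l r) ,
    choices-ascendingWalks-unique G l r girth 2L<g ,
    count ,
    λ S → ∈choices-ascendingWalks⇒IsVertex G l r girth L<g ,
          IsVertex⇒∈choices-ascendingWalks G l r girth L<g 1≤L
    where
    L = l * r
    L<g = ≤-<-trans (m≤m+n L L) 2L<g
    ascending = ascendingWalks G l r
    count : length (map (choices l r) ascending) ≡ (n * d * (d ∸ 1) ^ (L ∸ 1)) / 2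
    count = begin
      length (map (choices l r) ascending)     ≡⟨ length-map (choices l r) ascending ⟩
      length ascending                         ≡⟨ m*n/n≡m (length ascending) 2 ⟨
      length ascending * 2 / 2                 ≡⟨ cong (_/ 2) (length-NBWalks-halves G l r girth L<g 1≤L) ⟨
      length (NBWalks G L) / 2                 ≡⟨ cong (_/ 2) (length-NBWalks G regular 1≤L) ⟩
      n * (d * (d ∸ 1) ^ (L ∸ 1)) / 2          ≡⟨ cong (_/ 2) (*-assoc n d _) ⟨
      n * d * (d ∸ 1) ^ (L ∸ 1) / 2            ∎
      where open ≡-Reasoning

  length-candidateNeighbours : ∀ x → 1 ≤ l * r →
    length (candidateNeighbours G l r x) ≡ (l + 1) ^ 2 * d * (d ∸ 1) ^ (l * r ∸ 1)
  length-candidateNeighbours x 1≤L = begin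
    length (candidateNeighbours G l r x)
      ≡⟨ length-concatMap (λ j → concatMap (choicesThrough G l r x j) (allFin (suc l))) (allFin (suc l))
           (λ {j} _ → length-concatMap (choicesThrough G l r x j) (allFin (suc l)) (length-through {j})) ⟩
    length (allFin (suc l)) * (length (allFin (suc l)) * (d * (d ∸ 1) ^ (L ∸ 1)))
      ≡⟨ cong (λ k → k * (k * (d * (d ∸ 1) ^ (L ∸ 1)))) (length-tabulate {n = suc l} (λ i → i)) ⟩
    suc l * (suc l * (d * (d ∸ 1) ^ (L ∸ 1)))
      ≡⟨ square-distrib l d ((d ∸ 1) ^ (L ∸ 1)) ⟩
    (l + 1) ^ 2 * d * (d ∸ 1) ^ (L ∸ 1)
      ∎
    where
    open ≡-Reasoning
    L = l * r
    square-distrib : ∀ l d p → suc l * (suc l * (d * p)) ≡ (l + 1) * ((l + 1) * 1) * d * p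
    square-distrib = solve-∀
    length-through : ∀ {j i} → i ∈ allFin (suc l) →
                     length (choicesThrough G l r x j i) ≡ d * (d ∸ 1) ^ (L ∸ 1)
    length-through {j} {i} _ = begin
      length (choicesThrough G l r x j i)
        ≡⟨ length-map (choices l r) (NBWalksThrough G (x ‼ (toℕ j * r)) (toℕ i * r) (L ∸ toℕ i * r)) ⟩
      length (NBWalksThrough G (x ‼ (toℕ j * r)) (toℕ i * r) (L ∸ toℕ i * r))
        ≡⟨ length-NBWalksThrough G regular (x ‼ (toℕ j * r)) (toℕ i * r) (L ∸ toℕ i * r)
                                 (subst (1 ≤_) (sym i+[L∸i]≡L) 1≤L) ⟩
      d * (d ∸ 1) ^ (toℕ i * r + (L ∸ toℕ i * r) ∸ 1)
        ≡⟨ cong (λ e → d * (d ∸ 1) ^ (e ∸ 1)) i+[L∸i]≡L ⟩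
      d * (d ∸ 1) ^ (L ∸ 1)
        ∎
      where
      i+[L∸i]≡L = m+[n∸m]≡n (stepIndex≤ l r i)

  maxDegree : 1 ≤ l * r → MaxDegreeAtMost G l r ((l + 1) ^ 2 * d * (d ∸ 1) ^ (l * r ∸ 1))
  maxDegree 1≤L S isVertex ys unique-ys adjacent-ys with IsVertex⇒choices G l r isVertex
  ... | x , _ , _ , refl =
    ≤-trans (unique⊆⇒length≤ unique-ys ys⊆candidates) (≤-reflexive (length-candidateNeighbours x 1≤L))
    where
    ys⊆candidates : ∀ {T} → T ∈ ys → T ∈ candidateNeighbours G l r x
    ys⊆candidates T∈ with All.lookup adjacent-ys T∈
    ... | isVertexT , _ , _ , v∈S∩T with IsVertex⇒choices G l r isVertexT
    ...   | y , nby , steps-y , refl = ∈-candidateNeighbours G l r nby steps-y (x∈p∩q⁻ _ _ v∈S∩T)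

mainTheorem15 : ∀ (n d l r : ℕ) (G : Graph n) →
    3 ≤ d → Regular G d → 1 ≤ l → 1 ≤ r →
    GirthAtLeast G (suc (2 * (l * r))) →
    VertexCount G l r ((n * d * (d ∸ 1) ^ (l * r ∸ 1)) / 2)
    × MaxDegreeAtMost G l r ((l + 1) ^ 2 * d * (d ∸ 1) ^ (l * r ∸ 1))
mainTheorem15 n d l r G _ regular 1≤l 1≤r girth =
  vertexCount G regular l r girth 2L<2L+1 1≤L , maxDegree G regular l r 1≤L
  where
  1≤L : 1 ≤ l * r
  1≤L = *-mono-≤ 1≤l 1≤r
  2L<2L+1 : l * r + l * r < suc (2 * (l * r))
  2L<2L+1 = s≤s (≤-reflexive (cong (l * r +_) (sym (+-identityʳ (l * r)))))
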